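{- Let $G$ be a graph whose vertex set is a disjoint union $V(G)=A\cup B$ such that the induced subgraphs $G[A]$ and $G[B]$ have no isolated vertices. Then $\chi_o(G)\le \chi_o(G[A])+\chi_o(G[B])$.
   Context: All graphs are finite, simple and undirected. A proper vertex coloring $\varphi$ of a graph $G$ is called an odd coloring if for every non-isolated vertex $x$ of $G$ there is a color $c$ such that the number of neighbors $y\in N(x)$ with $\varphi(y)=c$ is odd. The odd chromatic number $\chi_o(G)$ is the minimum number of colors in an odd coloring of $G$. -}

module Defs where

open import Data.Nat using (ℕ; zero; suc; _+_; _≤_; _%_)
open import Data.Fin using (Fin; _≟_)
open import Data.Bool using (Bool; true; false; T; not)
open import Data.Unit using (tt)
open import Data.List using (List; allFin; map)
open import Data.Nat.ListAction using (sum)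
open import Data.Product using (Σ; ∃; _×_)
open import Relation.Nullary using (¬_; does)
open import Relation.Binary.PropositionalEquality using (_≡_; _≢_)

record Graph (n : ℕ) : Set where
  field
    adj    : Fin n → Fin n → Bool
    sym    : ∀ x y → adj x y ≡ adj y x
    irrefl : ∀ x → adj x x ≡ false
open Graph public

count : ∀ {n} → (Fin n → Bool) → ℕ
count {n} p = sum (map (λ y → if1 (p y)) (allFin n))
  where
    if1 : Bool → ℕ
    if1 true  = 1
    if1 false = 0

Odd : ℕ → Set
Odd m = m % 2 ≡ 1

NonIsolated : ∀ {n} → Graph n → Fin n → Set
NonIsolated G x = ∃ λ y → T (adj G x y)

IsOddColoring : ∀ {n k} → Graph n → (Fin n → Fin k) → Set
IsOddColoring {n} {k} G φ =
  (∀ x y → T (adj G x y) → φ x ≢ φ y)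
  × (∀ x → NonIsolated G x →
       ∃ λ (c : Fin k) → Odd (count (λ y → adj G x y Data.Bool.∧ does (φ y ≟ c))))

OddColorable : ∀ {n} → Graph n → ℕ → Set
OddColorable {n} G k = ∃ λ (φ : Fin n → Fin k) → IsOddColoring G φ

IsOddChromaticNumber : ∀ {n} → Graph n → ℕ → Set
IsOddChromaticNumber G c = OddColorable G c × (∀ m → OddColorable G m → c ≤ m)

-- The induced subgraph G[S] for S : Fin n → Bool (vertices v with T (S v)).
-- Its vertices are the v with T (S v); its edges are the edges of G between them.

NonIsolatedIn : ∀ {n} → Graph n → (Fin n → Bool) → Fin n → Set
NonIsolatedIn G S x = ∃ λ y → T (S y) × T (adj G x y)

NoIsolatedIn : ∀ {n} → Graph n → (Fin n → Bool) → Set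
NoIsolatedIn G S = ∀ x → T (S x) → NonIsolatedIn G S x

ColoringIn : ∀ {n} → (Fin n → Bool) → ℕ → Set
ColoringIn {n} S k = (v : Fin n) → T (S v) → Fin k

hasColor : ∀ {k} (b : Bool) → (T b → Fin k) → Fin k → Bool
hasColor true  f c = does (f tt ≟ c)
hasColor false f c = false

IsOddColoringIn : ∀ {n k} → Graph n → (S : Fin n → Bool) → ColoringIn S k → Set
IsOddColoringIn {n} {k} G S φ =
  (∀ x y (px : T (S x)) (py : T (S y)) → T (adj G x y) → φ x px ≢ φ y py)
  × (∀ x → T (S x) → NonIsolatedIn G S x →
       ∃ λ (c : Fin k) → Odd (count (λ y → adj G x y Data.Bool.∧ hasColor (S y) (φ y) c)))

OddColorableIn : ∀ {n} → Graph n → (Fin n → Bool) → ℕ → Set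
OddColorableIn G S k = ∃ λ (φ : ColoringIn S k) → IsOddColoringIn G S φ

IsOddChromaticNumberIn : ∀ {n} → Graph n → (Fin n → Bool) → ℕ → Set
IsOddChromaticNumberIn G S c = OddColorableIn G S c × (∀ m → OddColorableIn G S m → c ≤ m)

{-# OPTIONS --safe #-}
-- Give G[A] and G[B] disjoint palettes, the first a and the last b colors of
-- Fin (a + b), and color G by the union of the two odd colorings. An edge inside
-- A or inside B is proper by hypothesis, and an edge between A and B joins two
-- different palettes. A vertex x of A has a neighbour in A, so some color c is odd
-- on its neighbourhood in G[A]; only vertices of A use the first palette, so c
-- occurs exactly as often on the neighbourhood of x in G.
module Submission where

open import Defs hiding (sym)
open import Data.Nat using (ℕ; _+_; _≤_)
open import Data.Fin using (Fin; _≟_; _↑ˡ_; _↑ʳ_; splitAt)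
open import Data.Fin.Properties using (↑ˡ-injective; ↑ʳ-injective; splitAt-↑ˡ; splitAt-↑ʳ)
open import Data.Bool using (Bool; true; false; T; not; _∧_)
open import Data.Unit using (tt)
open import Data.List using (allFin)
open import Data.Nat.ListAction using (sum)
open import Data.Nat.Properties using (+-identityʳ)
open import Data.List.Properties using (map-cong)
open import Data.Product using (∃; _,_)
open import Function using (_∘_)
open import Function.Bundles using (mk⇔)
open import Relation.Nullary using (does)
open import Relation.Nullary.Decidable using (does-⇔; dec-false)
open import Relation.Binary.PropositionalEquality
  using (_≡_; _≢_; sym; trans; cong; subst)

-- The indicator inside count is local to Defs; it is reached as a count over Fin 1, up to + 0.
count-cong : ∀ {n} {p q : Fin n → Bool} → (∀ y → p y ≡ q y) → count p ≡ count q
count-cong {n} {p} {q} p≗q = cong sum (map-cong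
  (λ y → trans (sym (+-identityʳ _)) (trans (count₁-cong y) (+-identityʳ _))) (allFin n))
  where
  count₁-cong : ∀ y → count {1} (λ _ → p y) ≡ count {1} (λ _ → q y)
  count₁-cong y = cong (λ b → count (λ (_ : Fin 1) → b)) (p≗q y)

module _ {a b : ℕ} where

  ↑ˡ≢↑ʳ : (i : Fin a) (j : Fin b) → i ↑ˡ b ≢ a ↑ʳ j
  ↑ˡ≢↑ʳ i j eq
    with () ← trans (sym (splitAt-↑ˡ a i b)) (trans (cong (splitAt a) eq) (splitAt-↑ʳ a b j))

  does-↑ˡ-≟ : (i j : Fin a) → does (i ↑ˡ b ≟ j ↑ˡ b) ≡ does (i ≟ j)
  does-↑ˡ-≟ i j = does-⇔ (mk⇔ (↑ˡ-injective b i j) (cong (_↑ˡ b))) (i ↑ˡ b ≟ j ↑ˡ b) (i ≟ j)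

  does-↑ʳ-≟ : (i j : Fin b) → does (a ↑ʳ i ≟ a ↑ʳ j) ≡ does (i ≟ j)
  does-↑ʳ-≟ i j = does-⇔ (mk⇔ (↑ʳ-injective a i j) (cong (a ↑ʳ_))) (a ↑ʳ i ≟ a ↑ʳ j) (i ≟ j)

  -- t records whether the vertex lies in A.
  sideColor : (t : Bool) → (T t → Fin a) → (T (not t) → Fin b) → Fin (a + b)
  sideColor true  f g = f tt ↑ˡ b
  sideColor false f g = a ↑ʳ g tt

  sideColor-≢ : ∀ s t f g f′ g′ → (∀ ps pt → f ps ≢ f′ pt) → (∀ ps pt → g ps ≢ g′ pt)
    → sideColor s f g ≢ sideColor t f′ g′
  sideColor-≢ true  true  f g f′ g′ f≢ g≢ eq = f≢ tt tt (↑ˡ-injective b _ _ eq)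
  sideColor-≢ true  false f g f′ g′ f≢ g≢ eq = ↑ˡ≢↑ʳ _ _ eq
  sideColor-≢ false true  f g f′ g′ f≢ g≢ eq = ↑ˡ≢↑ʳ _ _ (sym eq)
  sideColor-≢ false false f g f′ g′ f≢ g≢ eq = g≢ tt tt (↑ʳ-injective a _ _ eq)

  sideColor-≟-↑ˡ : ∀ t f g (c : Fin a) → does (sideColor t f g ≟ c ↑ˡ b) ≡ hasColor t f c
  sideColor-≟-↑ˡ true  f g c = does-↑ˡ-≟ (f tt) c
  sideColor-≟-↑ˡ false f g c = dec-false (a ↑ʳ g tt ≟ c ↑ˡ b) (↑ˡ≢↑ʳ c (g tt) ∘ sym)

  sideColor-≟-↑ʳ : ∀ t f g (c : Fin b) → does (sideColor t f g ≟ a ↑ʳ c) ≡ hasColor (not t) g c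
  sideColor-≟-↑ʳ true  f g c = dec-false (f tt ↑ˡ b ≟ a ↑ʳ c) (↑ˡ≢↑ʳ (f tt) c)
  sideColor-≟-↑ʳ false f g c = does-↑ʳ-≟ (g tt) c

oddColorable-+ : ∀ {n} (G : Graph n) (A : Fin n → Bool) {a b}
  → NoIsolatedIn G A → NoIsolatedIn G (not ∘ A)
  → OddColorableIn G A a → OddColorableIn G (not ∘ A) b
  → OddColorable G (a + b)
oddColorable-+ {n} G A {a} {b} noA noB (φA , properA , oddA) (φB , properB , oddB) =
  ψ , proper , odd
  where
  ψ : Fin n → Fin (a + b)
  ψ v = sideColor (A v) (φA v) (φB v)

  proper : ∀ x y → T (adj G x y) → ψ x ≢ ψ y
  proper x y xy = sideColor-≢ (A x) (A y) (φA x) (φB x) (φA y) (φB y)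
    (λ px py → properA x y px py xy) (λ px py → properB x y px py xy)

  OddAt : Fin n → Set
  OddAt x = ∃ λ c → Odd (count (λ y → adj G x y ∧ does (ψ y ≟ c)))

  oddInA : ∀ x → T (A x) → OddAt x
  oddInA x x∈A with c , odd-c ← oddA x x∈A (noA x x∈A) =
    c ↑ˡ b , subst Odd (sym (count-cong λ y →
      cong (adj G x y ∧_) (sideColor-≟-↑ˡ (A y) (φA y) (φB y) c))) odd-c

  oddInB : ∀ x → T (not (A x)) → OddAt x
  oddInB x x∈B with c , odd-c ← oddB x x∈B (noB x x∈B) =
    a ↑ʳ c , subst Odd (sym (count-cong λ y →
      cong (adj G x y ∧_) (sideColor-≟-↑ʳ (A y) (φA y) (φB y) c))) odd-c

  odd : ∀ x → NonIsolated G x → OddAt x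
  odd x _ with A x | oddInA x | oddInB x
  ... | true  | inA | _   = inA tt
  ... | false | _   | inB = inB tt

mainTheorem5 : ∀ {n} (G : Graph n) (A : Fin n → Bool)
    → NoIsolatedIn G A → NoIsolatedIn G (not ∘ A)
    → ∀ (a b c : ℕ)
    → IsOddChromaticNumber G c
    → IsOddChromaticNumberIn G A a
    → IsOddChromaticNumberIn G (not ∘ A) b
    → c ≤ a + b
mainTheorem5 G A noA noB a b c (_ , c-minimal) (colorableA , _) (colorableB , _) =
  c-minimal (a + b) (oddColorable-+ G A noA noB colorableA colorableB)
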